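{- Let $q\ge5$ be prime, $q^*=(-1)^{(q-1)/2}q$ and $u_q(j)=(3^j-q^*(-1)^j)/4$. Let $d>1$ with $9\nmid d$, and let $\rho_q(d)$ be the period of $(u_q(j))_{j\ge1}$ modulo $d$. Then $\rho_q(d)$ is odd if and only if $d=q$ and $\operatorname{ord}_q(3)$ is odd.
   Context: The period modulo $d$ is the smallest $k\ge1$ such that $u_q(n)\equiv u_q(n+k)\pmod d$ for all sufficiently large $n$. $\operatorname{ord}_q(3)$ is the multiplicative order of $3$ modulo $q$. -}

module Defs where

open import Data.Nat as ℕ using (ℕ; zero; suc; _≥_; _∸_; _%_)
import Data.Nat.DivMod as ℕD
open import Data.Integer as ℤ using (ℤ; +_; -_; _-_; _*_)
open import Data.Integer.DivMod using () renaming (_/_ to _divℤ_)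
open import Data.Integer.Divisibility using (_∣_)
open import Data.Product using (Σ; _×_)
open import Relation.Binary.PropositionalEquality using (_≡_)

neg1^ : ℕ → ℤ
neg1^ zero    = + 1
neg1^ (suc n) = - neg1^ n

qstar : ℕ → ℤ
qstar q = neg1^ ((q ∸ 1) ℕD./ 2) * + q

-- u_q(j) = (3^j - q* (-1)^j) / 4   (exact division for odd prime q)
u : ℕ → ℕ → ℤ
u q j = ((+ (3 ℕ.^ j)) - qstar q * neg1^ j) divℤ (+ 4)

IsPeriod : ℕ → ℕ → ℕ → Set
IsPeriod q d k = Σ ℕ λ N → ∀ n → n ≥ N → (+ d) ∣ (u q (n ℕ.+ k) - u q n)

IsMinPeriod : ℕ → ℕ → ℕ → Set
IsMinPeriod q d k = (k ≥ 1) × IsPeriod q d k × (∀ m → m ≥ 1 → IsPeriod q d m → k ℕ.≤ m)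

IsOrder : ℕ → ℕ → ℕ → Set
IsOrder q a k = (k ≥ 1) × ((+ q) ∣ (+ (a ℕ.^ k) - + 1))
              × (∀ m → m ≥ 1 → (+ q) ∣ (+ (a ℕ.^ m) - + 1) → k ℕ.≤ m)

Odd : ℕ → Set
Odd k = k % 2 ≡ 1

{-# OPTIONS --safe #-}
-- Write D k n = u(n+k) - u(n) and A k = 3^k - 1. Since u(j) + u(j+1) = 3^j, we get
-- D k n + D k (n+1) = 3^n A k, so once d ∣ 3 A k, divisibility of D k n by d propagates
-- in both directions along n; with 9 ∤ d this makes k a period iff d ∣ 3 A k and d ∣ D k 1.
-- From 4 u(j) = 3^j - q* (-1)^j one gets 3 A k - 4 D k 1 = 2 q* for odd k, and D k 1 ≡ k
-- (mod 2), so an odd period forces d to be an odd divisor of 2q, i.e. d = q. At d = q,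
-- which divides q* and is prime to 12, k is a period iff q ∣ 3^k - 1, so ρ_q(q) = ord_q(3).
module Submission where

open import Defs
open import Data.Nat as ℕ using (ℕ; zero; suc; _≥_; _>_; _∸_)
import Data.Nat.Properties as ℕP
import Data.Nat.DivMod as ℕD
open import Data.Nat.Divisibility as ℕ∣ using () renaming (_∣_ to _∣ℕ_)
open import Data.Nat.Primality using (Prime; prime?; prime⇒irreducible; prime⇒nonZero; prime[2])
open import Data.Nat.Coprimality using (Coprime; coprime-divisor; prime⇒coprime)
open import Data.Integer as ℤ using (ℤ; +_; -_; _-_; _*_; _+_; ∣_∣)
import Data.Integer.Properties as ℤP
open import Data.Integer.DivMod using (a≡a%n+[a/n]*n; n%d<d) renaming (_/_ to _divℤ_; _%_ to _modℤ_)
open import Data.Integer.Divisibility using () renaming (_∣_ to _∣ᵤ_)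
open import Data.Integer.Divisibility.Signed as ℤ∣ using (_∣_; divides; _∣?_; ∣ᵤ⇒∣; ∣⇒∣ᵤ)
open import Data.Integer.Tactic.RingSolver using (solve-∀)
open import Data.Fin using (toℕ)
open import Data.Fin.Properties using (pigeonhole; toℕ-fromℕ<)
open import Data.Product using (Σ; _×_; _,_; proj₁; proj₂)
open import Data.Sum using (inj₁; inj₂)
open import Function.Bundles using (_⇔_; mk⇔; Equivalence)
open import Relation.Nullary using (¬_; Dec; yes; no; contradiction)
open import Relation.Nullary.Decidable using (_×-dec_; from-yes)
open import Relation.Binary.PropositionalEquality using (_≡_; refl; sym; trans; cong; cong₂; subst; subst₂; module ≡-Reasoning)

open ≡-Reasoning

IsLeast : (ℕ → Set) → ℕ → Set
IsLeast P k = k ≥ 1 × P k × (∀ m → m ≥ 1 → P m → k ℕ.≤ m)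

IsLeast-unique : ∀ {P m n} → IsLeast P m → IsLeast P n → m ≡ n
IsLeast-unique (m≥1 , Pm , m-least) (n≥1 , Pn , n-least) =
  ℕP.≤-antisym (m-least _ n≥1 Pn) (n-least _ m≥1 Pm)

IsLeast-resp-⇔ : ∀ {P R k} → (∀ m → P m ⇔ R m) → IsLeast P k → IsLeast R k
IsLeast-resp-⇔ P⇔R (k≥1 , Pk , k-least) =
  k≥1 , Equivalence.to (P⇔R _) Pk , λ m m≥1 Rm → k-least m m≥1 (Equivalence.from (P⇔R m) Rm)

first-witness : ∀ {P : ℕ → Set} → (∀ n → Dec (P n)) → ∀ b n → (∀ m → m ℕ.< n → ¬ P m) →
                P (n ℕ.+ b) → Σ ℕ λ k → P k × (∀ m → m ℕ.< k → ¬ P m)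
first-witness {P} P? zero n below Pn = n , subst P (ℕP.+-identityʳ n) Pn , below
first-witness {P} P? (suc b) n below Pn+b with P? n
... | yes Pn = n , Pn , below
... | no ¬Pn = first-witness P? b (suc n) below′ (subst P (ℕP.+-suc n b) Pn+b)
  where
  below′ : ∀ m → m ℕ.< suc n → ¬ P m
  below′ m m<1+n with ℕP.m<1+n⇒m<n∨m≡n m<1+n
  ... | inj₁ m<n = below m m<n
  ... | inj₂ refl = ¬Pn

IsLeast-exists : ∀ {P k} → (∀ n → Dec (P n)) → k ≥ 1 → P k → Σ ℕ (IsLeast P)
IsLeast-exists {P} {k} P? k≥1 Pk
  with first-witness (λ n → (1 ℕ.≤? n) ×-dec P? n) k 0 (λ _ ()) (k≥1 , Pk)
... | m , (m≥1 , Pm) , below =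
  m , m≥1 , Pm , λ n n≥1 Pn → ℕP.≮⇒≥ (λ n<m → below n n<m (n≥1 , Pn))

Odd⇒≡1+[n/2]*2 : ∀ {n} → Odd n → n ≡ 1 ℕ.+ n ℕD./ 2 ℕ.* 2
Odd⇒≡1+[n/2]*2 {n} n-odd = trans (ℕD.m≡m%n+[m/n]*n n 2) (cong (ℕ._+ n ℕD./ 2 ℕ.* 2) n-odd)

Odd⇒2∤ : ∀ {n} → Odd n → ¬ (2 ∣ℕ n)
Odd⇒2∤ {n} n-odd 2∣n = ℕP.0≢1+n (trans (sym (ℕ∣.n∣m⇒m%n≡0 n 2 2∣n)) n-odd)

prime-odd : ∀ {p} → Prime p → p ≥ 3 → Odd p
prime-odd {p} p-prime p≥3 with p ℕD.% 2 in p%2 | ℕD.m%n<n p 2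
... | 1 | _ = refl
... | suc (suc _) | ℕ.s≤s (ℕ.s≤s ())
... | 0 | _ with prime⇒irreducible p-prime (ℕ∣.m%n≡0⇒n∣m p 2 p%2)
...   | inj₁ ()
...   | inj₂ 2≡p = contradiction (subst (3 ℕ.≤_) (sym 2≡p) p≥3) λ { (ℕ.s≤s (ℕ.s≤s ())) }

prime3 : Prime 3
prime3 = from-yes (prime? 3)

coprime-to-prime : ∀ {p n} → Prime p → ¬ (p ∣ℕ n) → Coprime n p
coprime-to-prime p-prime p∤n (d∣n , d∣p) with prime⇒irreducible p-prime d∣p
... | inj₁ d≡1 = d≡1
... | inj₂ refl = contradiction d∣n p∤n

odd-divisor-of-2p : ∀ {p d} → Prime p → d > 1 → ¬ (2 ∣ℕ d) → d ∣ℕ 2 ℕ.* p → d ≡ p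
odd-divisor-of-2p p-prime d>1 2∤d d∣2p
  with prime⇒irreducible p-prime (coprime-divisor (coprime-to-prime prime[2] 2∤d) d∣2p)
... | inj₁ refl = contradiction d>1 (ℕP.<-irrefl refl)
... | inj₂ d≡p = d≡p

∣p[px]⇒∣px : ∀ {p d} x → Prime p → ¬ (p ℕ.* p ∣ℕ d) → d ∣ℕ p ℕ.* (p ℕ.* x) → d ∣ℕ p ℕ.* x
∣p[px]⇒∣px {p} {d} x p-prime p²∤d d∣ppx with p ℕ∣.∣? d
... | no p∤d = coprime-divisor (coprime-to-prime p-prime p∤d) d∣ppx
... | yes (ℕ∣.divides e refl) =
  subst (e ℕ.* p ∣ℕ_) (ℕP.*-comm x p) (ℕ∣.*-monoˡ-∣ p e∣x)
  where
  instance
    p≢0 : ℕ.NonZero p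
    p≢0 = prime⇒nonZero p-prime
  p∤e : ¬ (p ∣ℕ e)
  p∤e (ℕ∣.divides f refl) = p²∤d (ℕ∣.divides f (ℕP.*-assoc f p p))
  e∣px : e ∣ℕ p ℕ.* x
  e∣px = ℕ∣.*-cancelʳ-∣ p (subst (e ℕ.* p ∣ℕ_) (ℕP.*-comm p (p ℕ.* x)) d∣ppx)
  e∣x : e ∣ℕ x
  e∣x = coprime-divisor (coprime-to-prime p-prime p∤e) e∣px

∣p^[1+n]x⇒∣px : ∀ {p d} n x → Prime p → ¬ (p ℕ.* p ∣ℕ d) → d ∣ℕ p ℕ.^ suc n ℕ.* x → d ∣ℕ p ℕ.* x
∣p^[1+n]x⇒∣px {p} {d} zero x p-prime p²∤d h = subst (λ c → d ∣ℕ c ℕ.* x) (ℕP.*-identityʳ p) h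
∣p^[1+n]x⇒∣px {p} {d} (suc n) x p-prime p²∤d h =
  ∣p^[1+n]x⇒∣px n x p-prime p²∤d
    (subst (d ∣ℕ_) (sym (ℕP.*-assoc p (p ℕ.^ n) x))
      (∣p[px]⇒∣px (p ℕ.^ n ℕ.* x) p-prime p²∤d (subst (d ∣ℕ_) split h)))
  where
  split : p ℕ.^ suc (suc n) ℕ.* x ≡ p ℕ.* (p ℕ.* (p ℕ.^ n ℕ.* x))
  split = trans (ℕP.*-assoc p (p ℕ.^ suc n) x) (cong (p ℕ.*_) (ℕP.*-assoc p (p ℕ.^ n) x))

∣p^[1+n]X⇒∣pX : ∀ {p d} n X → Prime p → ¬ (p ℕ.* p ∣ℕ d) → + d ∣ + (p ℕ.^ suc n) * X → + d ∣ + p * X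
∣p^[1+n]X⇒∣pX {p} {d} n X p-prime p²∤d h =
  ∣ᵤ⇒∣ (subst (d ∣ℕ_) (sym (ℤP.abs-* (+ p) X))
    (∣p^[1+n]x⇒∣px n ∣ X ∣ p-prime p²∤d (subst (d ∣ℕ_) (ℤP.abs-* (+ (p ℕ.^ suc n)) X) (∣⇒∣ᵤ h))))

coprime-divisorℤ : ∀ {m n X} → Coprime m n → + m ∣ + n * X → + m ∣ X
coprime-divisorℤ {m} {n} {X} m⊥n h =
  ∣ᵤ⇒∣ (coprime-divisor m⊥n (subst (m ∣ℕ_) (ℤP.abs-* (+ n) X) (∣⇒∣ᵤ h)))

m*n<n⇒m≡0 : ∀ m {n} → m ℕ.* n ℕ.< n → m ≡ 0
m*n<n⇒m≡0 zero    _  = refl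
m*n<n⇒m≡0 (suc m) {n} lt = contradiction (ℕP.m≤n*m n (suc m)) (ℕP.<⇒≱ lt)

-- The remainder of i·n modulo n is |i - (i·n)/n|·n, yet it is smaller than n.
[i*n]/n≡i : ∀ i n .{{_ : ℕ.NonZero n}} → (i * + n) divℤ + n ≡ i
[i*n]/n≡i i n = sym (ℤP.i-j≡0⇒i≡j i quot (ℤP.∣i∣≡0⇒i≡0 (m*n<n⇒m≡0 ∣ i - quot ∣ r<n)))
  where
  quot : ℤ
  quot = (i * + n) divℤ + n
  rem : ℕ
  rem = (i * + n) modℤ + n
  rem≡ : + rem ≡ (i - quot) * + n
  rem≡ = begin
    + rem                                ≡⟨ rearrange (+ rem) quot (+ n) ⟩
    + rem + quot * + n - quot * + n      ≡⟨ cong (_- quot * + n) (sym (a≡a%n+[a/n]*n (i * + n) (+ n))) ⟩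
    i * + n - quot * + n                 ≡⟨ factor i quot (+ n) ⟩
    (i - quot) * + n                     ∎
    where
    rearrange : ∀ r q N → r ≡ r + q * N - q * N
    rearrange = solve-∀
    factor : ∀ i q N → i * N - q * N ≡ (i - q) * N
    factor = solve-∀
  r<n : ∣ i - quot ∣ ℕ.* n ℕ.< n
  r<n = subst (ℕ._< n) (trans (cong ∣_∣ rem≡) (ℤP.abs-* (i - quot) (+ n))) (n%d<d (i * + n) (+ n))

n*[i/n]≡i : ∀ {n} .{{_ : ℕ.NonZero n}} {i} → + n ∣ i → + n * (i divℤ + n) ≡ i
n*[i/n]≡i {n} (divides c refl) = trans (cong (+ n *_) ([i*n]/n≡i c n)) (ℤP.*-comm (+ n) c)

%≡⇒∣- : ∀ M .{{_ : ℕ.NonZero M}} x y → x ℕD.% M ≡ y ℕD.% M → + M ∣ + x - + y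
%≡⇒∣- M x y x≡y = divides (+ (x ℕD./ M) - + (y ℕD./ M)) (begin
  + x - + y                                                          ≡⟨ cong₂ _-_ (split x) (split y) ⟩
  + (x ℕD.% M) + + (x ℕD./ M) * + M - (+ (y ℕD.% M) + + (y ℕD./ M) * + M)
    ≡⟨ cong (λ r → + (x ℕD.% M) + + (x ℕD./ M) * + M - (+ r + + (y ℕD./ M) * + M)) (sym x≡y) ⟩
  + (x ℕD.% M) + + (x ℕD./ M) * + M - (+ (x ℕD.% M) + + (y ℕD./ M) * + M)
    ≡⟨ cancel (+ (x ℕD.% M)) (+ (x ℕD./ M)) (+ (y ℕD./ M)) (+ M) ⟩
  (+ (x ℕD./ M) - + (y ℕD./ M)) * + M                                ∎)
  where
  split : ∀ z → + z ≡ + (z ℕD.% M) + + (z ℕD./ M) * + M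
  split z = trans (cong +_ (ℕD.m≡m%n+[m/n]*n z M))
              (trans (ℤP.pos-+ (z ℕD.% M) (z ℕD./ M ℕ.* M)) (cong (λ w → + (z ℕD.% M) + w) (ℤP.pos-* (z ℕD./ M) M)))
  cancel : ∀ r a b N → r + a * N - (r + b * N) ≡ (a - b) * N
  cancel = solve-∀

pow3 : ℕ → ℤ
pow3 j = + (3 ℕ.^ j)

pow3-+ : ∀ m n → pow3 (m ℕ.+ n) ≡ pow3 m * pow3 n
pow3-+ m n = trans (cong +_ (ℕP.^-distribˡ-+-* 3 m n)) (ℤP.pos-* (3 ℕ.^ m) (3 ℕ.^ n))

pow3-suc : ∀ j → pow3 (suc j) ≡ + 3 * pow3 j
pow3-suc j = ℤP.pos-* 3 (3 ℕ.^ j)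

2∣3^j-1 : ∀ j → + 2 ∣ pow3 j - + 1
2∣3^j-1 zero    = divides (+ 0) refl
2∣3^j-1 (suc j) =
  subst (+ 2 ∣_) (trans (rearrange (pow3 j)) (cong (_- + 1) (sym (pow3-suc j))))
    (ℤ∣.∣m∣n⇒∣m+n (ℤ∣.∣n⇒∣m*n (+ 3) (2∣3^j-1 j)) (divides (+ 1) refl))
  where
  rearrange : ∀ P → + 3 * (P - + 1) + + 2 ≡ + 3 * P - + 1
  rearrange = solve-∀

pow3-collision : ∀ M .{{_ : ℕ.NonZero M}} → Σ ℕ λ a → Σ ℕ λ b → a ℕ.< b × + M ∣ pow3 b - pow3 a
pow3-collision M with pigeonhole (ℕP.n<1+n M) (λ i → (3 ℕ.^ toℕ i) ℕD.mod M)
... | i , j , i<j , same = toℕ i , toℕ j , i<j , %≡⇒∣- M _ _ residues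
  where
  residues : 3 ℕ.^ toℕ j ℕD.% M ≡ 3 ℕ.^ toℕ i ℕD.% M
  residues = trans (sym (toℕ-fromℕ< _)) (trans (cong toℕ (sym same)) (toℕ-fromℕ< _))

pow3-shift : ∀ {M a L} n → a ℕ.≤ n → + M ∣ pow3 (a ℕ.+ L) - pow3 a → + M ∣ pow3 (n ℕ.+ L) - pow3 n
pow3-shift {M} {a} {L} n a≤n M∣ = subst (+ M ∣_) shifted (ℤ∣.∣n⇒∣m*n (pow3 e) M∣)
  where
  e : ℕ
  e = n ∸ a
  e+a≡n : e ℕ.+ a ≡ n
  e+a≡n = ℕP.m∸n+n≡m a≤n
  distrib : ∀ E X Y → E * (X - Y) ≡ E * X - E * Y
  distrib = solve-∀
  shifted : pow3 e * (pow3 (a ℕ.+ L) - pow3 a) ≡ pow3 (n ℕ.+ L) - pow3 n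
  shifted = begin
    pow3 e * (pow3 (a ℕ.+ L) - pow3 a)           ≡⟨ distrib (pow3 e) (pow3 (a ℕ.+ L)) (pow3 a) ⟩
    pow3 e * pow3 (a ℕ.+ L) - pow3 e * pow3 a    ≡⟨ cong₂ _-_ (sym (pow3-+ e (a ℕ.+ L))) (sym (pow3-+ e a)) ⟩
    pow3 (e ℕ.+ (a ℕ.+ L)) - pow3 (e ℕ.+ a)      ≡⟨ cong₂ (λ x y → pow3 x - pow3 y)
                                                      (trans (sym (ℕP.+-assoc e a L)) (cong (ℕ._+ L) e+a≡n)) e+a≡n ⟩
    pow3 (n ℕ.+ L) - pow3 n                      ∎

neg1^-+ : ∀ m n → neg1^ (m ℕ.+ n) ≡ neg1^ m * neg1^ n
neg1^-+ zero    n = sym (ℤP.*-identityˡ (neg1^ n))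
neg1^-+ (suc m) n = trans (cong -_ (neg1^-+ m n)) (ℤP.neg-distribˡ-* (neg1^ m) (neg1^ n))

neg1^-*2 : ∀ t → neg1^ (t ℕ.* 2) ≡ + 1
neg1^-*2 zero    = refl
neg1^-*2 (suc t) = trans (ℤP.neg-involutive (neg1^ (t ℕ.* 2))) (neg1^-*2 t)

neg1^-odd : ∀ {k} → Odd k → neg1^ k ≡ - + 1
neg1^-odd {k} k-odd = trans (cong neg1^ (Odd⇒≡1+[n/2]*2 {k} k-odd)) (cong -_ (neg1^-*2 (k ℕD./ 2)))

∣neg1^∣≡1 : ∀ n → ∣ neg1^ n ∣ ≡ 1
∣neg1^∣≡1 zero    = refl
∣neg1^∣≡1 (suc n) = trans (ℤP.∣-i∣≡∣i∣ (neg1^ n)) (∣neg1^∣≡1 n)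

4∣3^j-neg1^j : ∀ j → + 4 ∣ pow3 j - neg1^ j
4∣3^j-neg1^j zero    = divides (+ 0) refl
4∣3^j-neg1^j (suc j) =
  subst (+ 4 ∣_) (trans (rearrange (pow3 j) (neg1^ j)) (cong (_- neg1^ (suc j)) (sym (pow3-suc j))))
    (ℤ∣.∣m∣n⇒∣m+n (ℤ∣.∣n⇒∣m*n (+ 3) (4∣3^j-neg1^j j)) (ℤ∣.∣m⇒∣m*n (neg1^ j) ℤ∣.∣-refl))
  where
  rearrange : ∀ P S → + 3 * (P - S) + + 4 * S ≡ + 3 * P - - S
  rearrange = solve-∀

qstar[1+m*2] : ∀ m → qstar (1 ℕ.+ m ℕ.* 2) ≡ neg1^ m * + (1 ℕ.+ m ℕ.* 2)
qstar[1+m*2] m = cong (λ e → neg1^ e * + (1 ℕ.+ m ℕ.* 2)) (ℕD.m*n/n≡m m 2)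

4∣neg1^m*[1+m*2]-1 : ∀ m → + 4 ∣ neg1^ m * + (1 ℕ.+ m ℕ.* 2) - + 1
4∣neg1^m*[1+m*2]-1 zero          = divides (+ 0) refl
4∣neg1^m*[1+m*2]-1 (suc zero)    = divides (- + 1) refl
4∣neg1^m*[1+m*2]-1 (suc (suc m)) =
  subst (+ 4 ∣_) (sym (rearrange (neg1^ m) (+ (1 ℕ.+ m ℕ.* 2))))
    (ℤ∣.∣m∣n⇒∣m+n (4∣neg1^m*[1+m*2]-1 m) (ℤ∣.∣m⇒∣m*n (neg1^ m) ℤ∣.∣-refl))
  where
  rearrange : ∀ S X → - - S * (+ 4 + X) - + 1 ≡ S * X - + 1 + + 4 * S
  rearrange = solve-∀

4∣qstar-1 : ∀ {q} → Odd q → + 4 ∣ qstar q - + 1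
4∣qstar-1 {q} q-odd =
  subst (λ n → + 4 ∣ qstar n - + 1) (sym (Odd⇒≡1+[n/2]*2 {q} q-odd))
    (subst (λ Q → + 4 ∣ Q - + 1) (sym (qstar[1+m*2] (q ℕD./ 2))) (4∣neg1^m*[1+m*2]-1 (q ℕD./ 2)))

∣qstar∣≡q : ∀ q → ∣ qstar q ∣ ≡ q
∣qstar∣≡q q = trans (ℤP.abs-* (neg1^ ((q ∸ 1) ℕD./ 2)) (+ q))
                (trans (cong (ℕ._* q) (∣neg1^∣≡1 ((q ∸ 1) ℕD./ 2))) (ℕP.*-identityˡ q))

q∣qstar : ∀ q → + q ∣ qstar q
q∣qstar q = ℤ∣.∣n⇒∣m*n (neg1^ ((q ∸ 1) ℕD./ 2)) ℤ∣.∣-refl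

u-closed-form : ∀ {q} → Odd q → ∀ j → + 4 * u q j ≡ pow3 j - qstar q * neg1^ j
u-closed-form {q} q-odd j =
  n*[i/n]≡i (subst (+ 4 ∣_) (rearrange (pow3 j) (qstar q) (neg1^ j))
    (ℤ∣.∣m∣n⇒∣m-n (4∣3^j-neg1^j j) (ℤ∣.∣m⇒∣m*n (neg1^ j) (4∣qstar-1 {q} q-odd))))
  where
  rearrange : ∀ P Q S → P - S - (Q - + 1) * S ≡ P - Q * S
  rearrange = solve-∀

-- Only the closed form 4 u(j) = 3^j - Q (-1)^j is used, so the integer division defining u never enters.
module Recurrence (Q : ℤ) (u : ℕ → ℤ) (closed-form : ∀ j → + 4 * u j ≡ pow3 j - Q * neg1^ j) where

  A : ℕ → ℤ
  A k = pow3 k - + 1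

  D : ℕ → ℕ → ℤ
  D k n = u (n ℕ.+ k) - u n

  u-step : ∀ j → u j + u (suc j) ≡ pow3 j
  u-step j = ℤP.*-cancelˡ-≡ (+ 4) _ _ (begin
    + 4 * (u j + u (suc j))                                    ≡⟨ ℤP.*-distribˡ-+ (+ 4) (u j) (u (suc j)) ⟩
    + 4 * u j + + 4 * u (suc j)                                ≡⟨ cong₂ _+_ (closed-form j) (closed-form (suc j)) ⟩
    pow3 j - Q * neg1^ j + (pow3 (suc j) - Q * - neg1^ j)      ≡⟨ cong (λ P → pow3 j - Q * neg1^ j + (P - Q * - neg1^ j)) (pow3-suc j) ⟩
    pow3 j - Q * neg1^ j + (+ 3 * pow3 j - Q * - neg1^ j)      ≡⟨ collect (pow3 j) Q (neg1^ j) ⟩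
    + 4 * pow3 j                                               ∎)
    where
    collect : ∀ P Q S → P - Q * S + (+ 3 * P - Q * - S) ≡ + 4 * P
    collect = solve-∀

  pow3*A : ∀ n k → pow3 n * A k ≡ pow3 (n ℕ.+ k) - pow3 n
  pow3*A n k = trans (distrib (pow3 n) (pow3 k)) (cong (_- pow3 n) (sym (pow3-+ n k)))
    where
    distrib : ∀ P K → P * (K - + 1) ≡ P * K - P
    distrib = solve-∀

  D-step : ∀ k n → D k n + D k (suc n) ≡ pow3 n * A k
  D-step k n = begin
    D k n + D k (suc n)                                               ≡⟨ regroup (u (n ℕ.+ k)) (u n) (u (suc (n ℕ.+ k))) (u (suc n)) ⟩
    (u (n ℕ.+ k) + u (suc (n ℕ.+ k))) - (u n + u (suc n))            ≡⟨ cong₂ _-_ (u-step (n ℕ.+ k)) (u-step n) ⟩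
    pow3 (n ℕ.+ k) - pow3 n                                           ≡⟨ sym (pow3*A n k) ⟩
    pow3 n * A k                                                      ∎
    where
    regroup : ∀ a b c d → a - b + (c - d) ≡ (a + c) - (b + d)
    regroup = solve-∀

  4D : ∀ k n → + 4 * D k n ≡ pow3 n * A k - Q * neg1^ n * (neg1^ k - + 1)
  4D k n = begin
    + 4 * (u (n ℕ.+ k) - u n)                                       ≡⟨ distrib (u (n ℕ.+ k)) (u n) ⟩
    + 4 * u (n ℕ.+ k) - + 4 * u n                                   ≡⟨ cong₂ _-_ (closed-form (n ℕ.+ k)) (closed-form n) ⟩
    pow3 (n ℕ.+ k) - Q * neg1^ (n ℕ.+ k) - (pow3 n - Q * neg1^ n)   ≡⟨ cong₂ (λ P S → P - Q * S - (pow3 n - Q * neg1^ n)) (pow3-+ n k) (neg1^-+ n k) ⟩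
    pow3 n * pow3 k - Q * (neg1^ n * neg1^ k) - (pow3 n - Q * neg1^ n) ≡⟨ regroup (pow3 n) (pow3 k) Q (neg1^ n) (neg1^ k) ⟩
    pow3 n * A k - Q * neg1^ n * (neg1^ k - + 1)                    ∎
    where
    distrib : ∀ X Y → + 4 * (X - Y) ≡ + 4 * X - + 4 * Y
    distrib = solve-∀
    regroup : ∀ P K Q S T → P * K - Q * (S * T) - (P - Q * S) ≡ P * (K - + 1) - Q * S * (T - + 1)
    regroup = solve-∀

  4D-even : ∀ t n → + 4 * D (t ℕ.* 2) n ≡ pow3 (n ℕ.+ t ℕ.* 2) - pow3 n
  4D-even t n = begin
    + 4 * D (t ℕ.* 2) n                                          ≡⟨ 4D (t ℕ.* 2) n ⟩
    pow3 n * A (t ℕ.* 2) - Q * neg1^ n * (neg1^ (t ℕ.* 2) - + 1) ≡⟨ cong (λ T → pow3 n * A (t ℕ.* 2) - Q * neg1^ n * (T - + 1)) (neg1^-*2 t) ⟩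
    pow3 n * A (t ℕ.* 2) - Q * neg1^ n * (+ 1 - + 1)             ≡⟨ vanish (pow3 n * A (t ℕ.* 2)) (Q * neg1^ n) ⟩
    pow3 n * A (t ℕ.* 2)                                         ≡⟨ pow3*A n (t ℕ.* 2) ⟩
    pow3 (n ℕ.+ t ℕ.* 2) - pow3 n                                ∎
    where
    vanish : ∀ X Y → X - Y * (+ 1 - + 1) ≡ X
    vanish = solve-∀

  u-parity-step : ∀ j → + 2 ∣ u (suc j) - u j - + 1
  u-parity-step j =
    subst (+ 2 ∣_) (trans (cong (λ P → P - + 1 + + 2 * - u j) (sym (u-step j))) (regroup (u j) (u (suc j))))
      (ℤ∣.∣m∣n⇒∣m+n (2∣3^j-1 j) (ℤ∣.∣m⇒∣m*n (- u j) ℤ∣.∣-refl))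
    where
    regroup : ∀ a b → a + b - + 1 + + 2 * - a ≡ b - a - + 1
    regroup = solve-∀

  D-parity : ∀ k j → + 2 ∣ D k j - + k
  D-parity zero j =
    subst (λ m → + 2 ∣ u m - u j - + 0) (sym (ℕP.+-identityʳ j))
      (subst (+ 2 ∣_) (sym (vanish (u j))) (divides (+ 0) refl))
    where
    vanish : ∀ x → x - x - + 0 ≡ + 0
    vanish = solve-∀
  D-parity (suc k) j =
    subst (+ 2 ∣_) (trans (regroup (u (suc (j ℕ.+ k))) (u (j ℕ.+ k)) (u j) (+ k))
                          (cong (λ m → u m - u j - + suc k) (sym (ℕP.+-suc j k))))
      (ℤ∣.∣m∣n⇒∣m+n (u-parity-step (j ℕ.+ k)) (D-parity k j))
    where
    regroup : ∀ a b c K → a - b - + 1 + (b - c - K) ≡ a - c - (+ 1 + K)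
    regroup = solve-∀

  Periodic : ℕ → ℕ → Set
  Periodic d k = Σ ℕ λ N → ∀ n → n ≥ N → + d ∣ᵤ D k n

  PeriodCriterion : ℕ → ℕ → Set
  PeriodCriterion d k = (+ d ∣ + 3 * A k) × (+ d ∣ D k 1)

  criterion? : ∀ d k → Dec (PeriodCriterion d k)
  criterion? d k = (+ d ∣? + 3 * A k) ×-dec (+ d ∣? D k 1)

  module _ {d k : ℕ} (d∣3A : + d ∣ + 3 * A k) where

    d∣pow3A : ∀ n → + d ∣ pow3 (suc n) * A k
    d∣pow3A n = subst (+ d ∣_) (trans (sym (ℤP.*-assoc (pow3 n) (+ 3) (A k)))
                                      (cong (_* A k) (trans (ℤP.*-comm (pow3 n) (+ 3)) (sym (pow3-suc n)))))
                  (ℤ∣.∣n⇒∣m*n (pow3 n) d∣3A)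

    ∣D-suc : ∀ {n} → + d ∣ D k (suc n) → + d ∣ D k (suc (suc n))
    ∣D-suc {n} h = ℤ∣.∣m+n∣m⇒∣n (subst (+ d ∣_) (sym (D-step k (suc n))) (d∣pow3A n)) h

    ∣D-pred : ∀ {n} → + d ∣ D k (suc (suc n)) → + d ∣ D k (suc n)
    ∣D-pred {n} h = ℤ∣.∣m+n∣n⇒∣m (subst (+ d ∣_) (sym (D-step k (suc n))) (d∣pow3A n)) h

    ∣D1⇒∣D : + d ∣ D k 1 → ∀ n → + d ∣ D k (suc n)
    ∣D1⇒∣D h zero    = h
    ∣D1⇒∣D h (suc n) = ∣D-suc (∣D1⇒∣D h n)

    ∣D⇒∣D1 : ∀ n → + d ∣ D k (suc n) → + d ∣ D k 1
    ∣D⇒∣D1 zero    h = h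
    ∣D⇒∣D1 (suc n) h = ∣D⇒∣D1 n (∣D-pred h)

  criterion⇒periodic : ∀ {d k} → PeriodCriterion d k → Periodic d k
  criterion⇒periodic {d} {k} (d∣3A , d∣D1) = 1 , periodic
    where
    periodic : ∀ n → n ≥ 1 → + d ∣ᵤ D k n
    periodic (suc n) _ = ∣⇒∣ᵤ (∣D1⇒∣D d∣3A d∣D1 n)

  -- Two consecutive multiples give d ∣ 3^(N+1) A k, and 9 ∤ d strips all but one factor 3.
  periodic⇒criterion : ∀ {d k} → ¬ (9 ∣ℕ d) → Periodic d k → PeriodCriterion d k
  periodic⇒criterion {d} {k} 9∤d (N , periodic) = d∣3A , ∣D⇒∣D1 d∣3A N (d∣D (suc N) (ℕP.n≤1+n N))
    where
    d∣D : ∀ n → n ≥ N → + d ∣ D k n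
    d∣D n n≥N = ∣ᵤ⇒∣ {+ d} {D k n} (periodic n n≥N)
    d∣3A : + d ∣ + 3 * A k
    d∣3A = ∣p^[1+n]X⇒∣pX N (A k) prime3 9∤d
             (subst (+ d ∣_) (D-step k (suc N))
               (ℤ∣.∣m∣n⇒∣m+n (d∣D (suc N) (ℕP.n≤1+n N)) (d∣D (suc (suc N)) (ℕP.m≤n+m N 2))))

  criterion⇔periodic : ∀ {d} → ¬ (9 ∣ℕ d) → ∀ k → PeriodCriterion d k ⇔ Periodic d k
  criterion⇔periodic {d} 9∤d k = mk⇔ (criterion⇒periodic {d} {k}) (periodic⇒criterion {d} {k} 9∤d)

  -- 3^n is eventually periodic modulo 4d; doubling the period also kills the sign (-1)^n.
  periodic-exists : ∀ d .{{_ : ℕ.NonZero d}} → Σ ℕ λ K → K ≥ 1 × Periodic d K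
  periodic-exists d with pow3-collision (4 ℕ.* d) {{ℕP.m*n≢0 4 d}}
  ... | a , b , a<b , 4d∣ = L ℕ.* 2 , ℕP.≤-trans (ℕP.m<n⇒0<n∸m a<b) (ℕP.m≤m*n L 2) , a , periodic
    where
    L : ℕ
    L = b ∸ a
    step : ∀ n → a ℕ.≤ n → + (4 ℕ.* d) ∣ pow3 (n ℕ.+ L) - pow3 n
    step n a≤n = pow3-shift n a≤n (subst (λ c → + (4 ℕ.* d) ∣ pow3 c - pow3 a) (sym (ℕP.m+[n∸m]≡n (ℕP.<⇒≤ a<b))) 4d∣)
    n+L*2≡n+L+L : ∀ n → n ℕ.+ L ℕ.* 2 ≡ n ℕ.+ L ℕ.+ L
    n+L*2≡n+L+L n = trans (cong (n ℕ.+_) (trans (ℕP.*-comm L 2) (cong (L ℕ.+_) (ℕP.+-identityʳ L))))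
                          (sym (ℕP.+-assoc n L L))
    telescope : ∀ X Y Z → X - Y + (Y - Z) ≡ X - Z
    telescope = solve-∀
    periodic : ∀ n → n ≥ a → + d ∣ᵤ D (L ℕ.* 2) n
    periodic n a≤n = ∣⇒∣ᵤ (ℤ∣.*-cancelˡ-∣ (+ 4) (subst₂ _∣_ (ℤP.pos-* 4 d) (sym (4D-even L n)) 4d∣4D))
      where
      4d∣4D : + (4 ℕ.* d) ∣ pow3 (n ℕ.+ L ℕ.* 2) - pow3 n
      4d∣4D = subst (+ (4 ℕ.* d) ∣_)
                (trans (telescope (pow3 (n ℕ.+ L ℕ.+ L)) (pow3 (n ℕ.+ L)) (pow3 n))
                       (cong (λ m → pow3 m - pow3 n) (sym (n+L*2≡n+L+L n))))
                (ℤ∣.∣m∣n⇒∣m+n (step (n ℕ.+ L) (ℕP.≤-trans a≤n (ℕP.m≤m+n n L))) (step n a≤n))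

  least-period : ∀ d .{{_ : ℕ.NonZero d}} → ¬ (9 ∣ℕ d) → Σ ℕ (IsLeast (Periodic d))
  least-period d 9∤d =
    let K , K≥1 , K-periodic = periodic-exists d
        ρ , ρ-least = IsLeast-exists {PeriodCriterion d} (criterion? d) K≥1 (periodic⇒criterion {d} {K} 9∤d K-periodic)
    in ρ , IsLeast-resp-⇔ {PeriodCriterion d} {Periodic d} (criterion⇔periodic {d} 9∤d) ρ-least

  odd-criterion⇒∣2Q : ∀ {d k} → Odd k → PeriodCriterion d k → + d ∣ + 2 * Q
  odd-criterion⇒∣2Q {d} {k} k-odd (d∣3A , d∣D1) =
    subst (+ d ∣_) 3A-4D≡2Q (ℤ∣.∣m∣n⇒∣m-n d∣3A (ℤ∣.∣n⇒∣m*n (+ 4) d∣D1))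
    where
    cancel : ∀ X Q → X - (X - Q * - + 1 * (- + 1 - + 1)) ≡ + 2 * Q
    cancel = solve-∀
    3A-4D≡2Q : + 3 * A k - + 4 * D k 1 ≡ + 2 * Q
    3A-4D≡2Q = begin
      + 3 * A k - + 4 * D k 1                                   ≡⟨ cong (λ X → + 3 * A k - X) (4D k 1) ⟩
      + 3 * A k - (+ 3 * A k - Q * - + 1 * (neg1^ k - + 1))     ≡⟨ cong (λ T → + 3 * A k - (+ 3 * A k - Q * - + 1 * (T - + 1))) (neg1^-odd {k} k-odd) ⟩
      + 3 * A k - (+ 3 * A k - Q * - + 1 * (- + 1 - + 1))       ≡⟨ cancel (+ 3 * A k) Q ⟩
      + 2 * Q                                                   ∎

  odd-criterion⇒2∤d : ∀ {d k} → Odd k → PeriodCriterion d k → ¬ (2 ∣ℕ d)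
  odd-criterion⇒2∤d {d} {k} k-odd (_ , d∣D1) 2∣d = Odd⇒2∤ {k} k-odd (∣⇒∣ᵤ 2∣k)
    where
    2∣D1 : + 2 ∣ D k 1
    2∣D1 = ℤ∣.∣-trans (∣ᵤ⇒∣ 2∣d) d∣D1
    cancel : ∀ x y → x - (x - y) ≡ y
    cancel = solve-∀
    2∣k : + 2 ∣ + k
    2∣k = subst (+ 2 ∣_) (cancel (D k 1) (+ k)) (ℤ∣.∣m∣n⇒∣m-n 2∣D1 (D-parity k 1))

  criterion⇒∣A : ∀ {m k} → Coprime m 3 → PeriodCriterion m k → + m ∣ A k
  criterion⇒∣A m⊥3 (m∣3A , _) = coprime-divisorℤ m⊥3 m∣3A

  ∣A⇒criterion : ∀ {m k} → Coprime m 4 → + m ∣ Q → + m ∣ A k → PeriodCriterion m k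
  ∣A⇒criterion {m} {k} m⊥4 m∣Q m∣A = m∣3A , coprime-divisorℤ m⊥4 (subst (+ m ∣_) (sym (4D k 1)) m∣4D1)
    where
    m∣3A : + m ∣ + 3 * A k
    m∣3A = ℤ∣.∣n⇒∣m*n (+ 3) m∣A
    m∣4D1 : + m ∣ + 3 * A k - Q * - + 1 * (neg1^ k - + 1)
    m∣4D1 = ℤ∣.∣m∣n⇒∣m-n m∣3A (ℤ∣.∣m⇒∣m*n (neg1^ k - + 1) (ℤ∣.∣m⇒∣m*n (- + 1) m∣Q))

  periodic⇔∣A : ∀ {m} → Coprime m 3 → Coprime m 4 → + m ∣ Q → ∀ k → Periodic m k ⇔ + m ∣ᵤ A k
  periodic⇔∣A {m} m⊥3 m⊥4 m∣Q k =
    mk⇔ (λ periodic → ∣⇒∣ᵤ (criterion⇒∣A {m} {k} m⊥3 (periodic⇒criterion {m} {k} 9∤m periodic)))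
        (λ m∣A → criterion⇒periodic {m} {k} (∣A⇒criterion {m} {k} m⊥4 m∣Q (∣ᵤ⇒∣ m∣A)))
    where
    9∤m : ¬ (9 ∣ℕ m)
    9∤m 9∣m = contradiction (m⊥3 (ℕ∣.∣-trans (ℕ∣.divides 3 refl) 9∣m , ℕ∣.∣-refl)) λ ()

lemma7 : (q : ℕ) → Prime q → q ≥ 5 → (d : ℕ) → d > 1 → ¬ (9 ∣ℕ d) →
    Σ ℕ λ ρ → IsMinPeriod q d ρ ×
      (Odd ρ ⇔ ((d ≡ q) × (Σ ℕ λ o → IsOrder q 3 o × Odd o)))
lemma7 q q-prime q≥5 d d>1 9∤d =
  let ρ , ρ-least = least-period d 9∤d in ρ , ρ-least , mk⇔ (odd⇒ ρ-least) (⇒odd ρ-least)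
  where
  open Recurrence (qstar q) (u q) (u-closed-form {q} (prime-odd q-prime (ℕP.≤-trans (ℕP.m≤m+n 3 2) q≥5)))
  instance
    d≢0 : ℕ.NonZero d
    d≢0 = ℕ.>-nonZero (ℕP.<-trans ℕ.z<s d>1)

  order-at-q : ∀ {ρ} → IsLeast (Periodic d) ρ → d ≡ q → IsOrder q 3 ρ
  order-at-q {ρ} ρ-least d≡q =
    IsLeast-resp-⇔ {Periodic q} (periodic⇔∣A {q} q⊥3 q⊥4 (q∣qstar q)) (subst (λ m → IsLeast (Periodic m) ρ) d≡q ρ-least)
    where
    q⊥3 : Coprime q 3
    q⊥3 = prime⇒coprime q-prime (ℕP.≤-trans (ℕP.n≤1+n 4) q≥5)
    q⊥4 : Coprime q 4
    q⊥4 = prime⇒coprime q-prime q≥5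

  odd⇒ : ∀ {ρ} → IsLeast (Periodic d) ρ → Odd ρ → (d ≡ q) × (Σ ℕ λ o → IsOrder q 3 o × Odd o)
  odd⇒ {ρ} ρ-least ρ-odd = d≡q , ρ , order-at-q ρ-least d≡q , ρ-odd
    where
    criterion : PeriodCriterion d ρ
    criterion = periodic⇒criterion {d} {ρ} 9∤d (proj₁ (proj₂ ρ-least))
    d∣2q : d ∣ℕ 2 ℕ.* q
    d∣2q = subst (d ∣ℕ_) (trans (ℤP.abs-* (+ 2) (qstar q)) (cong (2 ℕ.*_) (∣qstar∣≡q q)))
             (∣⇒∣ᵤ (odd-criterion⇒∣2Q {d} {ρ} ρ-odd criterion))
    d≡q : d ≡ q
    d≡q = odd-divisor-of-2p q-prime d>1 (odd-criterion⇒2∤d {d} {ρ} ρ-odd criterion) d∣2q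

  ⇒odd : ∀ {ρ} → IsLeast (Periodic d) ρ → (d ≡ q) × (Σ ℕ λ o → IsOrder q 3 o × Odd o) → Odd ρ
  ⇒odd ρ-least (d≡q , o , o-order , o-odd) =
    subst Odd (IsLeast-unique {λ k → + q ∣ᵤ A k} o-order (order-at-q ρ-least d≡q)) o-odd
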